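{- For every dual-normal program $P$, the set $\mathrm{SE}(P)$ of SE-models of $P$ is complete and closed under here-union.
   Context: A rule $r$ is an expression $a_1\vee\cdots\vee a_l\leftarrow a_{l+1},\ldots,a_m,\mathit{not}\ a_{m+1},\ldots,\mathit{not}\ a_n$ with propositional atoms; $H(r)$ head atoms, $B^+(r)$, $B^-(r)$ positive/negative body atoms; a constraint has $H(r)=\emptyset$. A program is a finite set of rules. A set $I$ of atoms satisfies $r$ if $(H(r)\cup B^-(r))\cap I\neq\emptyset$ or $B^+(r)\setminus I\neq\emptyset$; a model satisfies all rules. Reduct: $P^I=\{H(r)\leftarrow B^+(r)\mid r\in P, I\cap B^-(r)=\emptyset\}$. $P$ is dual-normal if every rule is a constraint or has $|B^+(r)|\le1$. An SE-interpretation is a pair $(X,Y)$ of sets of atoms with $X\subseteq Y$; it is an SE-model of $P$ if $Y$ is a model of $P$ and $X$ is a model of $P^Y$; $\mathrm{SE}(P)$ is the set of SE-models. A set $\mathcal{S}$ of SE-interpretations is complete if (1) $(X,Y)\in\mathcal{S}$ implies $(Y,Y)\in\mathcal{S}$, and (2) $(X,Y),(Z,Z)\in\mathcal{S}$ and $Y\subseteq Z$ imply $(X,Z)\in\mathcal{S}$. It is closed under here-union if $(X,Y),(X',Y)\in\mathcal{S}$ implies $(X\cup X',Y)\in\mathcal{S}$. -}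

module Defs where

open import Data.Bool using (Bool; true; false; _∨_)
open import Data.List using (List; []; _∷_; length)
open import Data.List.Relation.Unary.Any using (Any)
open import Data.List.Relation.Unary.All using (All)
open import Data.Nat using (ℕ; _≤_)
open import Data.Product using (_×_; Σ; _,_)
open import Data.Sum using (_⊎_)
open import Relation.Binary.PropositionalEquality using (_≡_)

-- Propositional atoms range over an arbitrary type A.
-- A (finite) rule  a1 ∨ … ∨ al ← a(l+1),…,am, not a(m+1),…,not an
record Rule (A : Set) : Set where
  constructor rule
  field
    H  : List A
    B⁺ : List A
    B⁻ : List A
open Rule public

IsConstraint : {A : Set} → Rule A → Set
IsConstraint r = H r ≡ []

Program : Set → Set
Program A = List (Rule A)

-- A set of atoms, given by its (decidable) characteristic function.
Interp : Set → Set
Interp A = A → Bool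

_∈I_ : {A : Set} → A → Interp A → Set
a ∈I I = I a ≡ true

_∉I_ : {A : Set} → A → Interp A → Set
a ∉I I = I a ≡ false

_⊆I_ : {A : Set} → Interp A → Interp A → Set
X ⊆I Y = ∀ a → a ∈I X → a ∈I Y

_∪I_ : {A : Set} → Interp A → Interp A → Interp A
(X ∪I Y) a = X a ∨ Y a

Satisfies : {A : Set} → Interp A → Rule A → Set
Satisfies I r =
  (Any (λ a → a ∈I I) (H r) ⊎ Any (λ a → a ∈I I) (B⁻ r))
  ⊎ Any (λ a → a ∉I I) (B⁺ r)

IsModel : {A : Set} → Interp A → Program A → Set
IsModel I P = All (Satisfies I) P

-- Reduct P^I = { H(r) ← B⁺(r) | r ∈ P, I ∩ B⁻(r) = ∅ }.
-- Rules of the reduct have empty negative body.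
data ReductRule {A : Set} (I : Interp A) : Rule A → Rule A → Set where
  keep : ∀ {r} → All (λ a → a ∉I I) (B⁻ r) →
         ReductRule I r (rule (H r) (B⁺ r) [])

IsModelOfReduct : {A : Set} → Interp A → Program A → Interp A → Set
IsModelOfReduct X P Y =
  All (λ r → ∀ r′ → ReductRule Y r r′ → Satisfies X r′) P

DualNormal : {A : Set} → Program A → Set
DualNormal P = All (λ r → IsConstraint r ⊎ length (B⁺ r) ≤ 1) P

SEInterp : Set → Set
SEInterp A = Interp A × Interp A

SESet : Set → Set₁
SESet A = Interp A → Interp A → Set

IsSEModel : {A : Set} → Program A → Interp A → Interp A → Set
IsSEModel P X Y = (X ⊆I Y) × IsModel Y P × IsModelOfReduct X P Y

SE : {A : Set} → Program A → SESet A
SE P = IsSEModel P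

Complete : {A : Set} → SESet A → Set
Complete S =
  (∀ X Y → S X Y → S Y Y) ×
  (∀ X Y Z → S X Y → S Z Z → Y ⊆I Z → S X Z)

ClosedUnderHereUnion : {A : Set} → SESet A → Set
ClosedUnderHereUnion S = ∀ X X′ Y → S X Y → S X′ Y → S (X ∪I X′) Y

module Submission where

-- Everything is reduced to single rules.  For a rule r, "X ⊨ r^Y" means that
-- X satisfies r's contribution to the reduct P^Y; it is equivalent to
-- "if B⁻(r) ∩ Y = ∅ then X satisfies the positive rule H(r) ← B⁺(r)"
-- (reduct-intro / reduct-elim).  With this reading:
--   * a model Y of r satisfies r^Y                          (model-satisfies-reduct),
--   * r^Z is weaker than r^Y when Y ⊆ Z                     (reduct-antitone),
--   * for dual-normal r, models X, X′ ⊆ Y of r^Y give a model X ∪ X′, provided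
--     Y ⊨ r (needed for constraints)                        (reduct-here-union).
-- Only the last fact uses dual-normality: a missing positive body atom is
-- shared by X and X′ when |B⁺(r)| ≤ 1, and for a constraint it is already
-- missing from Y ⊇ X ∪ X′.

open import Defs
open import Data.Bool using (true; false)
open import Data.List using (List; []; _∷_; length)
open import Data.List.Relation.Unary.Any as Any using (Any; here)
open import Data.List.Relation.Unary.All as All using (All; lookupAny)
open import Data.Nat using (_≤_; s≤s)
open import Data.Product using (_×_; _,_)
open import Data.Sum using (_⊎_; inj₁; inj₂)
open import Data.Empty using (⊥)
open import Relation.Binary.PropositionalEquality using (_≡_; refl; sym; trans; subst)

module _ {A : Set} where

  ∈-∉-disjoint : {I : Interp A} {a : A} → a ∈I I → a ∉I I → ⊥
  ∈-∉-disjoint a∈I a∉I with () ← trans (sym a∈I) a∉I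

  Any∈-All∉-disjoint : {I : Interp A} {l : List A} →
    Any (_∈I I) l → All (_∉I I) l → ⊥
  Any∈-All∉-disjoint {I} any∈ all∉ with lookupAny all∉ any∈
  ... | a∉I , a∈I = ∈-∉-disjoint {I} a∈I a∉I

  ∉-antitone : {Y Z : Interp A} → Y ⊆I Z → {a : A} → a ∉I Z → a ∉I Y
  ∉-antitone {Y} Y⊆Z {a} a∉Z with Y a in a∈?Y
  ... | false = refl
  ... | true  with () ← trans (sym (Y⊆Z a a∈?Y)) a∉Z

  ∪-inl : (X X′ : Interp A) {a : A} → a ∈I X → a ∈I (X ∪I X′)
  ∪-inl X X′ a∈X rewrite a∈X = refl

  ∪-inr : (X X′ : Interp A) {a : A} → a ∈I X′ → a ∈I (X ∪I X′)
  ∪-inr X X′ {a} a∈X′ with X a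
  ... | true  = refl
  ... | false = a∈X′

  ∪-∉ : (X X′ : Interp A) {a : A} → a ∉I X → a ∉I X′ → a ∉I (X ∪I X′)
  ∪-∉ X X′ a∉X a∉X′ rewrite a∉X = a∉X′

  ∪-least : {X X′ Y : Interp A} → X ⊆I Y → X′ ⊆I Y → (X ∪I X′) ⊆I Y
  ∪-least {X} X⊆Y X′⊆Y a a∈X∪X′ with X a in a∈?X
  ... | true  = X⊆Y a a∈?X
  ... | false = X′⊆Y a a∈X∪X′

  SatisfiesReduct : Interp A → Rule A → Interp A → Set
  SatisfiesReduct X r Y = ∀ r′ → ReductRule Y r r′ → Satisfies X r′

  SatisfiesPositive : Interp A → Rule A → Set
  SatisfiesPositive X r = Any (_∈I X) (H r) ⊎ Any (_∉I X) (B⁺ r)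

  reduct-intro : {X Y : Interp A} {r : Rule A} →
    (All (_∉I Y) (B⁻ r) → SatisfiesPositive X r) → SatisfiesReduct X r Y
  reduct-intro sat _ (keep B⁻∩Y=∅) with sat B⁻∩Y=∅
  ... | inj₁ head∈X = inj₁ (inj₁ head∈X)
  ... | inj₂ body∉X = inj₂ body∉X

  reduct-elim : {X Y : Interp A} {r : Rule A} →
    SatisfiesReduct X r Y → All (_∉I Y) (B⁻ r) → SatisfiesPositive X r
  reduct-elim sat B⁻∩Y=∅ with sat _ (keep B⁻∩Y=∅)
  ... | inj₁ (inj₁ head∈X) = inj₁ head∈X
  ... | inj₂ body∉X        = inj₂ body∉X

  model-satisfies-positive : {Y : Interp A} {r : Rule A} →
    Satisfies Y r → All (_∉I Y) (B⁻ r) → SatisfiesPositive Y r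
  model-satisfies-positive (inj₁ (inj₁ head∈Y)) _ = inj₁ head∈Y
  model-satisfies-positive (inj₁ (inj₂ neg∈Y)) B⁻∩Y=∅
    with () ← Any∈-All∉-disjoint neg∈Y B⁻∩Y=∅
  model-satisfies-positive (inj₂ body∉Y) _ = inj₂ body∉Y

  model-satisfies-reduct : {Y : Interp A} {r : Rule A} →
    Satisfies Y r → SatisfiesReduct Y r Y
  model-satisfies-reduct Y⊨r = reduct-intro (model-satisfies-positive Y⊨r)

  -- Completeness, condition (2): enlarging Y only removes reduct rules.
  reduct-antitone : {X Y Z : Interp A} {r : Rule A} → Y ⊆I Z →
    SatisfiesReduct X r Y → SatisfiesReduct X r Z
  reduct-antitone Y⊆Z X⊨rʸ =
    reduct-intro (λ B⁻∩Z=∅ → reduct-elim X⊨rʸ (All.map (∉-antitone Y⊆Z) B⁻∩Z=∅))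

  short-body-∪ : (X X′ : Interp A) (l : List A) → length l ≤ 1 →
    Any (_∉I X) l → Any (_∉I X′) l → Any (_∉I (X ∪I X′)) l
  short-body-∪ X X′ (_ ∷ []) _ (here a∉X) (here a∉X′) = here (∪-∉ X X′ a∉X a∉X′)
  short-body-∪ X X′ (_ ∷ _ ∷ _) (s≤s ()) _ _

  constraint-body-∉ : {Y : Interp A} {r : Rule A} → IsConstraint r →
    Satisfies Y r → All (_∉I Y) (B⁻ r) → Any (_∉I Y) (B⁺ r)
  constraint-body-∉ {Y} H≡[] Y⊨r B⁻∩Y=∅
    with model-satisfies-positive Y⊨r B⁻∩Y=∅
  ... | inj₁ head∈Y with () ← subst (Any (_∈I Y)) H≡[] head∈Y
  ... | inj₂ body∉Y = body∉Y

  reduct-here-union : {X X′ Y : Interp A} {r : Rule A} →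
    X ⊆I Y → X′ ⊆I Y → IsConstraint r ⊎ length (B⁺ r) ≤ 1 → Satisfies Y r →
    SatisfiesReduct X r Y → SatisfiesReduct X′ r Y →
    SatisfiesReduct (X ∪I X′) r Y
  reduct-here-union {X} {X′} {Y} {r} X⊆Y X′⊆Y dual Y⊨r X⊨rʸ X′⊨rʸ =
    reduct-intro (union-positive dual)
    where
    union-positive : IsConstraint r ⊎ length (B⁺ r) ≤ 1 →
      All (_∉I Y) (B⁻ r) → SatisfiesPositive (X ∪I X′) r
    union-positive dual′ B⁻∩Y=∅
      with reduct-elim X⊨rʸ B⁻∩Y=∅ | reduct-elim X′⊨rʸ B⁻∩Y=∅ | dual′
    ... | inj₁ head∈X | _ | _ = inj₁ (Any.map (∪-inl X X′) head∈X)
    ... | _ | inj₁ head∈X′ | _ = inj₁ (Any.map (∪-inr X X′) head∈X′)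
    ... | inj₂ body∉X | inj₂ body∉X′ | inj₂ short =
      inj₂ (short-body-∪ X X′ (B⁺ r) short body∉X body∉X′)
    ... | inj₂ _ | inj₂ _ | inj₁ constraint =
      inj₂ (Any.map (∉-antitone (∪-least X⊆Y X′⊆Y))
                    (constraint-body-∉ constraint Y⊨r B⁻∩Y=∅))

theorem5 : {A : Set} (P : Program A) → DualNormal P →
    Complete (SE P) × ClosedUnderHereUnion (SE P)
theorem5 P dual = (total-model , extend-there) , here-union
  where
  total-model : ∀ X Y → SE P X Y → SE P Y Y
  total-model _ _ (_ , Y⊨P , _) =
    (λ _ a∈Y → a∈Y) , Y⊨P , All.map model-satisfies-reduct Y⊨P

  extend-there : ∀ X Y Z → SE P X Y → SE P Z Z → Y ⊆I Z → SE P X Z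
  extend-there _ _ _ (X⊆Y , _ , X⊨Pʸ) (_ , Z⊨P , _) Y⊆Z =
    (λ a a∈X → Y⊆Z a (X⊆Y a a∈X)) , Z⊨P , All.map (reduct-antitone Y⊆Z) X⊨Pʸ

  here-union : ∀ X X′ Y → SE P X Y → SE P X′ Y → SE P (X ∪I X′) Y
  here-union _ _ _ (X⊆Y , Y⊨P , X⊨Pʸ) (X′⊆Y , _ , X′⊨Pʸ) =
    ∪-least X⊆Y X′⊆Y , Y⊨P ,
    All.zipWith (λ ((dual-r , Y⊨r) , (X⊨rʸ , X′⊨rʸ)) →
                  reduct-here-union X⊆Y X′⊆Y dual-r Y⊨r X⊨rʸ X′⊨rʸ)
                (All.zip (dual , Y⊨P) , All.zip (X⊨Pʸ , X′⊨Pʸ))
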